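{- Let $T$ be a rooted tree with root $r$ and vertex set $V$, let $U\subseteq V$ with $r\in U$, and let $\phi_U:V\to U$ map each vertex $v$ to the first vertex of $U$ encountered on the path from $v$ to the root (so $\phi_U(v)=v$ if $v\in U$). Let $a,b,c,d\in V$ be distinct vertices satisfying: (i) the paths $P(a,b)$ and $P(c,d)$ are vertex-disjoint; (ii) for every triple of distinct $x,y,z\in\{a,b,c,d\}$, $\phi_U(x)\neq\phi_U(\mathrm{lca}(y,z))$. Then the paths $P(\phi_U(a),\phi_U(b))$ and $P(\phi_U(c),\phi_U(d))$ are vertex-disjoint.
   Context: $P(x,y)$ denotes the unique path between vertices $x$ and $y$ in $T$ (including its endpoints), and $\mathrm{lca}(x,y)$ denotes the lowest common ancestor of $x$ and $y$ in the rooted tree $T$. -}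

module Defs where

open import Data.Nat using (ℕ; zero; suc)
open import Data.Fin using (Fin; _≟_)
open import Data.Fin.Subset using (Subset; _∈_; _∉_)
open import Data.Fin.Subset.Properties using (_∈?_)
open import Data.List using (List; []; _∷_; map; upTo)
open import Data.Bool.ListAction using (any)
open import Data.Bool using (Bool; true; false; if_then_else_)
open import Data.Product using (∃; _×_)
open import Data.Sum using (_⊎_)
open import Relation.Nullary using (¬_)
open import Relation.Nullary.Decidable using (⌊_⌋)
open import Relation.Binary.PropositionalEquality using (_≡_)

-- A rooted tree on the vertex set V = Fin n is given by its root r and a
-- parent function (the parent of the root is the root itself); the tree edges
-- are {v , parent v} for v ≠ r.

iter : ∀ {n} → (Fin n → Fin n) → ℕ → Fin n → Fin n
iter p zero    v = v
iter p (suc k) v = p (iter p k v)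

IsRootedTree : ∀ {n} → (Fin n → Fin n) → Fin n → Set
IsRootedTree {n} p r = (p r ≡ r) × (∀ v → ∃ λ k → iter p k v ≡ r)

Anc : ∀ {n} → (Fin n → Fin n) → Fin n → Fin n → Set
Anc p u v = ∃ λ k → iter p k v ≡ u

-- the vertices v, parent v, parent² v, ... , parentⁿ⁻¹ v :
-- in a tree on n vertices this is the path from v to the root (followed by
-- repetitions of the root).
ancestors : ∀ {n} → (Fin n → Fin n) → Fin n → List (Fin n)
ancestors {n} p v = map (λ k → iter p k v) (upTo n)

firstWith : ∀ {A : Set} → (A → Bool) → A → List A → A
firstWith t d []       = d
firstWith t d (x ∷ xs) = if t x then x else firstWith t d xs

memb : ∀ {n} → Fin n → List (Fin n) → Bool
memb u xs = any (λ w → ⌊ w ≟ u ⌋) xs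

-- lowest common ancestor: first vertex on the path from x to the root
-- that is also an ancestor of y  (default r is never used in a tree)
lca : ∀ {n} → (Fin n → Fin n) → Fin n → Fin n → Fin n → Fin n
lca p r x y = firstWith (λ w → memb w (ancestors p y)) r (ancestors p x)

-- φ_U(v): first vertex of U on the path from v to the root
-- (default r is never used since r ∈ U)
φ : ∀ {n} → (Fin n → Fin n) → Fin n → Subset n → Fin n → Fin n
φ p r U v = firstWith (λ w → ⌊ w ∈? U ⌋) r (ancestors p v)

-- v lies on the (unique) tree path P(x,y): the path from x up to lca(x,y)
-- and down to y, i.e. v is an ancestor of x or of y and a descendant of lca(x,y).
OnPath : ∀ {n} → (Fin n → Fin n) → Fin n → Fin n → Fin n → Fin n → Set
OnPath p r x y v = (Anc p v x ⊎ Anc p v y) × Anc p (lca p r x y) v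

PathsDisjoint : ∀ {n} → (Fin n → Fin n) → Fin n → Fin n → Fin n → Fin n → Fin n → Set
PathsDisjoint p r x y z w = ∀ v → OnPath p r x y v → ¬ OnPath p r z w v

OneOf : ∀ {n} → Fin n → Fin n → Fin n → Fin n → Fin n → Set
OneOf a b c d x = x ≡ a ⊎ x ≡ b ⊎ x ≡ c ⊎ x ≡ d

{-# OPTIONS --safe #-}
module Submission where

-- If v lay on both image paths, it would be an ancestor of φ x and φ y for some
-- x ∈ {a, b} and y ∈ {c, d}; let x̄, ȳ be their partners. It suffices to show
-- that L = lca x x̄ (and symmetrically lca y ȳ) is an ancestor of v, for then v
-- lies on P(x, x̄) and on P(y, ȳ), contradicting (i). As v and L are both
-- ancestors of x, we may assume v is an ancestor of L. The tool is that φ is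
-- constant on the path from any u up to φ u. So if φ L differs from φ x and φ x̄,
-- L is an ancestor of φ x and φ x̄, hence of lca (φ x) (φ x̄), an ancestor of v.
-- If instead φ L = φ x, then (ii) for x and lca x̄ y makes L an ancestor of y; by
-- (i) it is then also an ancestor of ȳ, and (ii) for y and ȳ makes it an
-- ancestor of lca (φ y) (φ ȳ), hence of v.

open import Defs
open import Data.Nat using (ℕ; zero; suc; _+_; _*_; _∸_; _≤_; _<_; s≤s⁻¹; _<?_; NonZero; >-nonZero)
open import Data.Nat.Properties using (≤-total; ≤-trans; <⇒≤; <-≤-trans; ≮⇒≥; m≤m*n; m∸n+n≡m; m<n⇒0<n∸m; n<1+n)
open import Data.Fin using (Fin; toℕ; _≟_)
open import Data.Fin.Properties using (pigeonhole; toℕ<n)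
open import Data.Fin.Subset using (Subset; _∈_)
open import Data.Fin.Subset.Properties using (_∈?_)
open import Data.List using (applyUpTo)
open import Data.List.Properties using (map-upTo)
open import Data.List.Membership.Propositional using () renaming (_∈_ to _∈ₗ_)
open import Data.List.Membership.Propositional.Properties using (∈-applyUpTo⁺; ∈-applyUpTo⁻)
import Data.List.Relation.Unary.Any as Any
open import Data.List.Relation.Unary.Any.Properties using (any⁺; any⁻)
open import Data.Bool using (Bool; true; false; T)
open import Data.Product using (∃; _×_; _,_; proj₁; proj₂)
open import Data.Sum using (_⊎_; inj₁; inj₂; [_,_]′; swap)
open import Data.Empty using (⊥; ⊥-elim)
open import Relation.Nullary using (¬_; yes; no)
open import Relation.Nullary.Decidable using (⌊_⌋; toWitness; fromWitness)
open import Relation.Binary.PropositionalEquality using (_≡_; _≢_; refl; sym; trans; cong; subst; ≢-sym)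
open import Function using (_∘_; id)

firstWith-applyUpTo : ∀ {A : Set} (t : A → Bool) (d : A) (f : ℕ → A) {m j} →
  j < m → T (t (f j)) →
  ∃ λ i → firstWith t d (applyUpTo f m) ≡ f i × T (t (f i)) × (∀ {k} → k < i → ¬ T (t (f k)))
firstWith-applyUpTo t d f {suc m} {j} j<m tfj with t (f 0) in eq
... | true = 0 , refl , subst T (sym eq) _ , λ ()
firstWith-applyUpTo t d f {suc m} {zero} _ tf₀ | false = ⊥-elim (subst T eq tf₀)
firstWith-applyUpTo t d f {suc m} {suc j} j<m tfj | false
  with i , first≡ , tfi , before ← firstWith-applyUpTo t d (f ∘ suc) (s≤s⁻¹ j<m) tfj
  = suc i , first≡ , tfi , λ { {zero} _ → subst T eq ; {suc k} k<i → before (s≤s⁻¹ k<i) }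

memb⁻ : ∀ {n} {u : Fin n} xs → T (memb u xs) → u ∈ₗ xs
memb⁻ xs u∈xs = Any.map (sym ∘ toWitness) (any⁻ _ xs u∈xs)

memb⁺ : ∀ {n} {u : Fin n} {xs} → u ∈ₗ xs → T (memb u xs)
memb⁺ u∈xs = any⁺ _ (Any.map (fromWitness ∘ sym) u∈xs)

module Ancestry {n : ℕ} (p : Fin n → Fin n) where

  iter-+ : ∀ k m v → iter p (k + m) v ≡ iter p k (iter p m v)
  iter-+ zero    m v = refl
  iter-+ (suc k) m v = cong p (iter-+ k m v)

  Anc-refl : ∀ {v} → Anc p v v
  Anc-refl = 0 , refl

  Anc-trans : ∀ {u w v} → Anc p u w → Anc p w v → Anc p u v
  Anc-trans {v = v} (k , refl) (m , refl) = k + m , iter-+ k m v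

  Anc-iter-≤ : ∀ {i j} v → i ≤ j → Anc p (iter p j v) (iter p i v)
  Anc-iter-≤ {i} {j} v i≤j =
    j ∸ i , trans (sym (iter-+ (j ∸ i) i v)) (cong (λ k → iter p k v) (m∸n+n≡m i≤j))

  Anc-total : ∀ {u w x} → Anc p u x → Anc p w x → Anc p u w ⊎ Anc p w u
  Anc-total {x = x} (i , refl) (j , refl) with ≤-total i j
  ... | inj₁ i≤j = inj₂ (Anc-iter-≤ x i≤j)
  ... | inj₂ j≤i = inj₁ (Anc-iter-≤ x j≤i)

module RootedTree {n : ℕ} {p : Fin n → Fin n} {r : Fin n} (tree : IsRootedTree p r) where

  open Ancestry p public

  iter-root : ∀ k → iter p k r ≡ r
  iter-root zero    = refl
  iter-root (suc k) = trans (cong p (iter-root k)) (proj₁ tree)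

  Anc-root : ∀ {u} → Anc p u r → u ≡ r
  Anc-root (k , refl) = iter-root k

  stays-at-root : ∀ {k m v} → iter p k v ≡ r → k ≤ m → iter p m v ≡ r
  stays-at-root {v = v} kth≡r k≤m = Anc-root (subst (Anc p _) kth≡r (Anc-iter-≤ v k≤m))

  iter-* : ∀ {k u} → iter p k u ≡ u → ∀ m → iter p (m * k) u ≡ u
  iter-* kth≡u zero    = refl
  iter-* {k} {u} kth≡u (suc m) =
    trans (iter-+ k (m * k) u) (trans (cong (iter p k) (iter-* kth≡u m)) kth≡u)

  periodic⇒root : ∀ {k u} .{{_ : NonZero k}} → iter p k u ≡ u → u ≡ r
  periodic⇒root {k} {u} kth≡u with K , Kth≡r ← proj₂ tree u =
    trans (sym (iter-* kth≡u K)) (stays-at-root Kth≡r (m≤m*n K k))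

  Anc-antisym : ∀ {u v} → Anc p u v → Anc p v u → u ≡ v
  Anc-antisym (zero , refl) _ = refl
  Anc-antisym {u} {v} (suc k , kth≡u) (m , mth≡v) = trans u≡r (sym v≡r)
    where
    u≡r : u ≡ r
    u≡r = periodic⇒root {suc k + m}
            (trans (iter-+ (suc k) m u) (trans (cong (iter p (suc k)) mth≡v) kth≡u))
    v≡r : v ≡ r
    v≡r = Anc-root (subst (Anc p v) u≡r (m , mth≡v))

  root-within-n : ∀ v → ∃ λ i → i < n × iter p i v ≡ r
  root-within-n v
    with i , j , i<j , ith≡jth ← pigeonhole (n<1+n n) (λ (i : Fin (suc n)) → iter p (toℕ i) v)
    = toℕ i , <-≤-trans i<j (s≤s⁻¹ (toℕ<n j)) , periodic⇒root {{>-nonZero (m<n⇒0<n∸m i<j)}} cycle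
    where
    cycle : iter p (toℕ j ∸ toℕ i) (iter p (toℕ i) v) ≡ iter p (toℕ i) v
    cycle = trans (sym (iter-+ (toℕ j ∸ toℕ i) (toℕ i) v))
                  (trans (cong (λ k → iter p k v) (m∸n+n≡m (<⇒≤ i<j))) (sym ith≡jth))

  Anc-within-n : ∀ {u v} → Anc p u v → ∃ λ j → j < n × iter p j v ≡ u
  Anc-within-n {v = v} (k , refl) with k <? n
  ... | yes k<n = k , k<n , refl
  ... | no k≮n with i , i<n , ith≡r ← root-within-n v =
    i , i<n , trans ith≡r (sym (stays-at-root ith≡r (≤-trans (<⇒≤ i<n) (≮⇒≥ k≮n))))

  memb-ancestors⁻ : ∀ {u v} → T (memb u (ancestors p v)) → Anc p u v
  memb-ancestors⁻ {u} {v} u∈anc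
    with j , _ , u≡jth ← ∈-applyUpTo⁻ (λ k → iter p k v)
                           (subst (u ∈ₗ_) (map-upTo _ n) (memb⁻ _ u∈anc))
    = j , sym u≡jth

  memb-ancestors⁺ : ∀ {u v} → Anc p u v → T (memb u (ancestors p v))
  memb-ancestors⁺ {u} {v} u≼v with j , j<n , refl ← Anc-within-n u≼v =
    memb⁺ (subst (u ∈ₗ_) (sym (map-upTo _ n)) (∈-applyUpTo⁺ (λ k → iter p k v) j<n))

  record LowestAncestor (P : Fin n → Set) (v f : Fin n) : Set where
    field
      satisfies : P f
      ancestor  : Anc p f v
      lowest    : ∀ {u} → P u → Anc p u v → Anc p u f

  LowestAncestor-map : ∀ {P Q : Fin n → Set} {v f} → (∀ {u} → P u → Q u) → (∀ {u} → Q u → P u) →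
    LowestAncestor P v f → LowestAncestor Q v f
  LowestAncestor-map P⇒Q Q⇒P low = record
    { satisfies = P⇒Q satisfies ; ancestor = ancestor ; lowest = lowest ∘ Q⇒P }
    where open LowestAncestor low

  lowest-iter : ∀ (t : Fin n → Bool) {i v u} → (∀ {k} → k < i → ¬ T (t (iter p k v))) →
    T (t u) → Anc p u v → Anc p u (iter p i v)
  lowest-iter t {i} {v} before tu (k , refl) with k <? i
  ... | yes k<i = ⊥-elim (before k<i tu)
  ... | no k≮i  = Anc-iter-≤ v (≮⇒≥ k≮i)

  firstWith-ancestors : ∀ (t : Fin n → Bool) → T (t r) → ∀ v →
    LowestAncestor (T ∘ t) v (firstWith t r (ancestors p v))
  firstWith-ancestors t tr v
    with j , j<n , jth≡r ← root-within-n v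
    with i , first≡ , ti , before ←
           firstWith-applyUpTo t r (λ k → iter p k v) j<n (subst (T ∘ t) (sym jth≡r) tr)
    = subst (LowestAncestor (T ∘ t) v) (sym (trans (cong (firstWith t r) (map-upTo _ n)) first≡))
        (record { satisfies = ti ; ancestor = i , refl ; lowest = lowest-iter t before })

  lca-lowest : ∀ x y → LowestAncestor (λ u → Anc p u y) x (lca p r x y)
  lca-lowest x y = LowestAncestor-map memb-ancestors⁻ memb-ancestors⁺
    (firstWith-ancestors (λ w → memb w (ancestors p y)) (memb-ancestors⁺ (proj₂ tree y)) x)

  lca-Ancˡ : ∀ x y → Anc p (lca p r x y) x
  lca-Ancˡ x y = LowestAncestor.ancestor (lca-lowest x y)

  lca-Ancʳ : ∀ x y → Anc p (lca p r x y) y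
  lca-Ancʳ x y = LowestAncestor.satisfies (lca-lowest x y)

  lca-greatest : ∀ {u x y} → Anc p u x → Anc p u y → Anc p u (lca p r x y)
  lca-greatest {x = x} {y} u≼x u≼y = LowestAncestor.lowest (lca-lowest x y) u≼y u≼x

  lca-comm : ∀ x y → lca p r x y ≡ lca p r y x
  lca-comm x y = Anc-antisym (lca-greatest (lca-Ancʳ x y) (lca-Ancˡ x y))
                             (lca-greatest (lca-Ancʳ y x) (lca-Ancˡ y x))

  lca-OnPath : ∀ x y → OnPath p r x y (lca p r x y)
  lca-OnPath x y = inj₁ (lca-Ancˡ x y) , Anc-refl

  OnPath-comm : ∀ {x y v} → OnPath p r x y v → OnPath p r y x v
  OnPath-comm {x} {y} {v} (side , lca≼v) = swap side , subst (λ w → Anc p w v) (lca-comm x y) lca≼v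

  PathsDisjoint-swapˡ : ∀ {x y z w} → PathsDisjoint p r x y z w → PathsDisjoint p r y x z w
  PathsDisjoint-swapˡ disj v on₁ on₂ = disj v (OnPath-comm on₁) on₂

  PathsDisjoint-swapʳ : ∀ {x y z w} → PathsDisjoint p r x y z w → PathsDisjoint p r x y w z
  PathsDisjoint-swapʳ disj v on₁ on₂ = disj v on₁ (OnPath-comm on₂)

  PathsDisjoint-sym : ∀ {x y z w} → PathsDisjoint p r x y z w → PathsDisjoint p r z w x y
  PathsDisjoint-sym disj v on₁ on₂ = disj v on₂ on₁

  off-path-Anc : ∀ {u y ȳ} → Anc p u y → ¬ OnPath p r y ȳ u → Anc p u ȳ
  off-path-Anc {y = y} {ȳ} u≼y u∉P with Anc-total (lca-Ancˡ y ȳ) u≼y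
  ... | inj₁ lca≼u = ⊥-elim (u∉P (inj₁ u≼y , lca≼u))
  ... | inj₂ u≼lca = Anc-trans u≼lca (lca-Ancʳ y ȳ)

  module Projection (U : Subset n) (r∈U : r ∈ U) where

    φU : Fin n → Fin n
    φU = φ p r U

    φ-lowest : ∀ v → LowestAncestor (_∈ U) v (φU v)
    φ-lowest = LowestAncestor-map toWitness fromWitness
             ∘ firstWith-ancestors (λ w → ⌊ w ∈? U ⌋) (fromWitness r∈U)

    φ-∈ : ∀ v → φU v ∈ U
    φ-∈ v = LowestAncestor.satisfies (φ-lowest v)

    φ-Anc : ∀ v → Anc p (φU v) v
    φ-Anc v = LowestAncestor.ancestor (φ-lowest v)

    φ-greatest : ∀ {u v} → u ∈ U → Anc p u v → Anc p u (φU v)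
    φ-greatest {v = v} = LowestAncestor.lowest (φ-lowest v)

    φ-constant : ∀ {u w} → Anc p (φU u) w → Anc p w u → φU w ≡ φU u
    φ-constant {u} {w} φu≼w w≼u =
      Anc-antisym (φ-greatest (φ-∈ w) (Anc-trans (φ-Anc w) w≼u)) (φ-greatest (φ-∈ u) φu≼w)

    φ≢⇒Anc : ∀ {w z x} → Anc p w x → Anc p z x → Anc p (φU w) z → φU w ≢ φU z → Anc p w z
    φ≢⇒Anc w≼x z≼x φw≼z φw≢φz with Anc-total z≼x w≼x
    ... | inj₁ z≼w = ⊥-elim (φw≢φz (sym (φ-constant φw≼z z≼w)))
    ... | inj₂ w≼z = w≼z

    φ≢⇒Anc-φ : ∀ {w u} → Anc p w u → φU w ≢ φU u → Anc p w (φU u)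
    φ≢⇒Anc-φ {u = u} w≼u φw≢φu with Anc-total (φ-Anc u) w≼u
    ... | inj₁ φu≼w = ⊥-elim (φw≢φu (φ-constant φu≼w w≼u))
    ... | inj₂ w≼φu = w≼φu

    φ-lca-Anc-lca-φ : ∀ x y → Anc p (φU (lca p r x y)) (lca p r (φU x) (φU y))
    φ-lca-Anc-lca-φ x y = lca-greatest (φ-greatest (φ-∈ L) (Anc-trans (φ-Anc L) (lca-Ancˡ x y)))
                                       (φ-greatest (φ-∈ L) (Anc-trans (φ-Anc L) (lca-Ancʳ x y)))
      where
      L : Fin n
      L = lca p r x y

    lca-Anc-shared-vertex : ∀ {x x̄ y ȳ v} →
      φU x ≢ φU (lca p r x̄ y) → φU x̄ ≢ φU (lca p r x y) →
      φU y ≢ φU (lca p r x x̄) → φU ȳ ≢ φU (lca p r x x̄) →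
      PathsDisjoint p r x x̄ y ȳ →
      Anc p v (φU x) → Anc p v (φU y) →
      Anc p (lca p r (φU x) (φU x̄)) v → Anc p (lca p r (φU y) (φU ȳ)) v →
      Anc p (lca p r x x̄) v
    lca-Anc-shared-vertex {x} {x̄} {y} {ȳ} {v} φx≢ φx̄≢ φy≢ φȳ≢ disj v≼φx v≼φy M≼v M′≼v =
      [ id , below ]′ (Anc-total (lca-Ancˡ x x̄) (Anc-trans v≼φx (φ-Anc x)))
      where
      L : Fin n
      L = lca p r x x̄
      φL≼v : Anc p (φU L) v
      φL≼v = Anc-trans (φ-lca-Anc-lca-φ x x̄) M≼v

      via-y : Anc p L y → Anc p L v
      via-y L≼y = Anc-trans (lca-greatest (φ≢⇒Anc-φ L≼y (φy≢ ∘ sym)) (φ≢⇒Anc-φ L≼ȳ (φȳ≢ ∘ sym))) M′≼v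
        where
        L≼ȳ : Anc p L ȳ
        L≼ȳ = off-path-Anc L≼y (disj L (lca-OnPath x x̄))

      -- v is a common ancestor of w and y, so φ L ≼ v ≼ lca w y.
      through-y : ∀ {w} → Anc p v L → Anc p L w → φU L ≢ φU (lca p r w y) → Anc p L v
      through-y {w} v≼L L≼w φL≢ = via-y (Anc-trans
        (φ≢⇒Anc L≼w (lca-Ancˡ w y)
          (Anc-trans φL≼v (lca-greatest (Anc-trans v≼L L≼w) (Anc-trans v≼φy (φ-Anc y)))) φL≢)
        (lca-Ancʳ w y))

      below : Anc p v L → Anc p L v
      below v≼L with φU x ≟ φU L | φU x̄ ≟ φU L
      ... | yes φx≡φL | _ = through-y v≼L (lca-Ancʳ x x̄) (φx≢ ∘ trans φx≡φL)
      ... | _ | yes φx̄≡φL = through-y v≼L (lca-Ancˡ x x̄) (φx̄≢ ∘ trans φx̄≡φL)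
      ... | no φx≢φL | no φx̄≢φL =
        Anc-trans (lca-greatest (φ≢⇒Anc-φ (lca-Ancˡ x x̄) (φx≢φL ∘ sym))
                                (φ≢⇒Anc-φ (lca-Ancʳ x x̄) (φx̄≢φL ∘ sym)))
                  M≼v

    module _ (S : Fin n → Set)
      (separated : ∀ x y z → S x → S y → S z → x ≢ y → x ≢ z → y ≢ z →
                   φU x ≢ φU (lca p r y z)) where

      image-paths-disjoint-at : ∀ {x x̄ y ȳ} → S x → S x̄ → S y → S ȳ →
        x ≢ x̄ → x ≢ y → x ≢ ȳ → x̄ ≢ y → x̄ ≢ ȳ → y ≢ ȳ →
        PathsDisjoint p r x x̄ y ȳ → ∀ {v} → Anc p v (φU x) → Anc p v (φU y) →
        OnPath p r (φU x) (φU x̄) v → ¬ OnPath p r (φU y) (φU ȳ) v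
      image-paths-disjoint-at {x} {x̄} {y} {ȳ} sx sx̄ sy sȳ x≢x̄ x≢y x≢ȳ x̄≢y x̄≢ȳ y≢ȳ disj {v}
                              v≼φx v≼φy (_ , M≼v) (_ , M′≼v) =
        disj v (inj₁ (Anc-trans v≼φx (φ-Anc x)) , L≼v) (inj₁ (Anc-trans v≼φy (φ-Anc y)) , L′≼v)
        where
        L≼v : Anc p (lca p r x x̄) v
        L≼v = lca-Anc-shared-vertex
          (separated x x̄ y sx sx̄ sy x≢x̄ x≢y x̄≢y) (separated x̄ x y sx̄ sx sy (≢-sym x≢x̄) x̄≢y x≢y)
          (separated y x x̄ sy sx sx̄ (≢-sym x≢y) (≢-sym x̄≢y) x≢x̄)
          (separated ȳ x x̄ sȳ sx sx̄ (≢-sym x≢ȳ) (≢-sym x̄≢ȳ) x≢x̄)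
          disj v≼φx v≼φy M≼v M′≼v
        L′≼v : Anc p (lca p r y ȳ) v
        L′≼v = lca-Anc-shared-vertex
          (separated y ȳ x sy sȳ sx y≢ȳ (≢-sym x≢y) (≢-sym x≢ȳ))
          (separated ȳ y x sȳ sy sx (≢-sym y≢ȳ) (≢-sym x≢ȳ) (≢-sym x≢y))
          (separated x y ȳ sx sy sȳ x≢y x≢ȳ y≢ȳ) (separated x̄ y ȳ sx̄ sy sȳ x̄≢y x̄≢ȳ y≢ȳ)
          (PathsDisjoint-sym disj) v≼φy v≼φx M′≼v M≼v

lemma11 : ∀ {n : ℕ} (parent : Fin n → Fin n) (r : Fin n) →
    IsRootedTree parent r →
    (U : Subset n) → r ∈ U →
    (a b c d : Fin n) →
    a ≢ b → a ≢ c → a ≢ d → b ≢ c → b ≢ d → c ≢ d →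
    PathsDisjoint parent r a b c d →
    (∀ x y z → OneOf a b c d x → OneOf a b c d y → OneOf a b c d z →
      x ≢ y → x ≢ z → y ≢ z →
      φ parent r U x ≢ φ parent r U (lca parent r y z)) →
    PathsDisjoint parent r (φ parent r U a) (φ parent r U b)
                           (φ parent r U c) (φ parent r U d)
lemma11 parent r tree U r∈U a b c d a≢b a≢c a≢d b≢c b≢d c≢d disj separated v on₁ on₂ =
  by-sides (proj₁ on₁) (proj₁ on₂)
  where
  open RootedTree tree
  open Projection U r∈U

  v≼φ : Fin _ → Set
  v≼φ x = Anc parent v (φU x)

  a∈ : OneOf a b c d a
  a∈ = inj₁ refl
  b∈ : OneOf a b c d b
  b∈ = inj₂ (inj₁ refl)
  c∈ : OneOf a b c d c
  c∈ = inj₂ (inj₂ (inj₁ refl))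
  d∈ : OneOf a b c d d
  d∈ = inj₂ (inj₂ (inj₂ refl))

  by-sides : v≼φ a ⊎ v≼φ b → v≼φ c ⊎ v≼φ d → ⊥
  by-sides (inj₁ v≼φa) (inj₁ v≼φc) =
    image-paths-disjoint-at _ separated a∈ b∈ c∈ d∈ a≢b a≢c a≢d b≢c b≢d c≢d
      disj v≼φa v≼φc on₁ on₂
  by-sides (inj₂ v≼φb) (inj₁ v≼φc) =
    image-paths-disjoint-at _ separated b∈ a∈ c∈ d∈ (≢-sym a≢b) b≢c b≢d a≢c a≢d c≢d
      (PathsDisjoint-swapˡ disj) v≼φb v≼φc (OnPath-comm on₁) on₂
  by-sides (inj₁ v≼φa) (inj₂ v≼φd) =
    image-paths-disjoint-at _ separated a∈ b∈ d∈ c∈ a≢b a≢d a≢c b≢d b≢c (≢-sym c≢d)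
      (PathsDisjoint-swapʳ disj) v≼φa v≼φd on₁ (OnPath-comm on₂)
  by-sides (inj₂ v≼φb) (inj₂ v≼φd) =
    image-paths-disjoint-at _ separated b∈ a∈ d∈ c∈ (≢-sym a≢b) b≢d b≢c a≢d a≢c (≢-sym c≢d)
      (PathsDisjoint-swapˡ (PathsDisjoint-swapʳ disj)) v≼φb v≼φd (OnPath-comm on₁) (OnPath-comm on₂)
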